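{- For every $d\ge1$ and $n\ge1$, the number of (structurally different) $2$-alternating guillotine partitions of a $d$-dimensional box by $n$ cuts equals $d(d-1)^{n-1}C_n$, where $C_n=\frac{1}{n+1}\binom{2n}{n}$ is the $n$-th Catalan number.
   Context: Guillotine partitions: Let $B$ be an axis-parallel box in $\mathbb{R}^d$. A partition of $B$ is a set $S$ of $k>0$ interior-disjoint axis-parallel boxes whose union is $B$. $S$ is a guillotine partition if $k=1$, or there are a hyperplane $h$ (orthogonal to some axis $x_i$) and disjoint nonempty $S^-,S^+\subset S$ such that $h$ splits $B$ into interior-disjoint boxes $B^-$ (below $h$) and $B^+$ (above $h$), with $S^\pm$ a guillotine partition of $B^\pm$; the boxes arising at recursive stages are subboxes. The principal cuts of a subbox are the (necessarily mutually parallel) cuts that split that subbox into two parts in this sense. Structure is recorded by a colored binary tree: trivial partition gives the empty tree; otherwise take the highest splitting hyperplane of $B$ (orthogonal to $x_i$), color the root $i$, and let the left/right subtrees be the trees of $B^-$/$B^+$. Partitions with the same tree are structurally identical and counted once; the number of cuts is the number of vertices. A guillotine partition is $2$-alternating if every subbox (including $B$) has at most one principal cut. -}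

module Defs where

open import Data.Nat using (ℕ; zero; suc; _+_; _*_; _∸_; _^_; _≤_; _/_)
open import Data.Nat.Combinatorics using (_C_)
open import Data.Fin using (Fin; _≟_)
open import Data.List using (List; []; _∷_; length)
open import Data.List.Membership.Propositional using (_∈_)
open import Data.List.Relation.Unary.Unique.Propositional using (Unique)
open import Data.List.Relation.Unary.All using (All)
open import Data.Product using (Σ; _×_; _,_)
open import Relation.Binary.PropositionalEquality using (_≡_)
open import Relation.Nullary using (yes; no)
open import Function.Bundles using (_⇔_)

-- Used both for
--  * cut trees: a recording of one recursive guillotine splitting procedure
--    of the box B (node i L R = B is split by a hyperplane orthogonal to x_i
--    into B⁻ partitioned according to L and B⁺ partitioned according to R),
--    i.e. an abstract guillotine partition of a d-dimensional box; and
--  * the structural (canonical) colored binary tree of the paper.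
data Tree (d : ℕ) : Set where
  leaf : Tree d
  node : Fin d → Tree d → Tree d → Tree d

size : ∀ {d} → Tree d → ℕ
size leaf = 0
size (node _ l r) = suc (size l + size r)

-- Principal cuts of the box partitioned by a cut tree, in direction i
-- (i.e. the cuts orthogonal to x_i that span the whole box).  A cut of B orthogonal to x_i spans B iff it is the root
-- cut or a principal x_i-cut of B⁻ or of B⁺; cuts orthogonal to other axes
-- at the root level never span B.
principalIn : ∀ {d} → Fin d → Tree d → ℕ
principalIn i leaf = 0
principalIn i (node j l r) with i ≟ j
... | yes _ = principalIn i l + suc (principalIn i r)
... | no  _ = 0

-- number of principal cuts of the whole box (all are in the root direction)
principal : ∀ {d} → Tree d → ℕ
principal leaf = 0
principal (node j l r) = principalIn j (node j l r)

data TwoAlternating {d : ℕ} : Tree d → Set where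
  leaf : TwoAlternating leaf
  node : ∀ {j l r} → principal (node j l r) ≤ 1 →
         TwoAlternating l → TwoAlternating r → TwoAlternating (node j l r)

-- Structural tree of the partition: the root is the highest principal cut
-- (orthogonal to x_i), left subtree = structural tree of B⁻ (below it),
-- right subtree = structural tree of B⁺ (above it).
-- `attach i L R` : given structural trees L of the part below a cut
-- orthogonal to x_i and R of the part above it, build the structural tree
-- of the union: if R's highest cut is also an x_i cut (hence spans the
-- union), it stays the highest cut and we recurse into the part below it.
attach : ∀ {d} → Fin d → Tree d → Tree d → Tree d
attach i L leaf = node i L leaf
attach i L (node j A C) with i ≟ j
... | yes _ = node j (attach i L A) C
... | no  _ = node i L (node j A C)

structTree : ∀ {d} → Tree d → Tree d
structTree leaf = leaf
structTree (node i l r) = attach i (structTree l) (structTree r)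

IsTwoAltStructure : (d n : ℕ) → Tree d → Set
IsTwoAltStructure d n t =
  Σ (Tree d) λ p → TwoAlternating p × size p ≡ n × structTree p ≡ t

-- the number of structurally different 2-alternating guillotine partitions
-- of a d-box with n cuts is N: a duplicate-free list of exactly the
-- structural trees that arise, of length N.
NumTwoAlt : (d n N : ℕ) → Set
NumTwoAlt d n N =
  Σ (List (Tree d)) λ ts →
    Unique ts × length ts ≡ N × (∀ t → (t ∈ ts) ⇔ IsTwoAltStructure d n t)

catalan : ℕ → ℕ
catalan n = ((2 * n) C n) / suc n

module Submission where

open import Defs
open import Data.Nat
  using (ℕ; zero; suc; _+_; _*_; _∸_; _^_; _≤_; _≥_; _!; _/_; s≤s; s≤s⁻¹; z≤n; NonZero)
open import Data.Nat.Properties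
  using (+-assoc; +-comm; +-suc; +-identityʳ; *-assoc; *-identityˡ; *-zeroʳ; suc-injective; ≤-reflexive;
         m≤m+n; m+n∸m≡n; m+1+n≢0; m+n≡0⇒m≡0; m+n≡0⇒n≡0; n≤0⇒n≡0; _!*_!≢0)
open import Data.Nat.DivMod using (m*n/n≡m; /-congˡ; /-congʳ)
open import Data.Nat.Combinatorics using (_C_; nCk≡n!/k![n-k]!)
open import Data.Nat.Tactic.RingSolver using (solve-∀)
open import Data.Fin using (Fin; punchIn; _≟_)
open import Data.Fin.Properties using (punchIn-injective; punchInᵢ≢i; punchIn-punchOut)
open import Data.Vec as Vec using (Vec; []; _∷_; head)
open import Data.Vec.Properties using (∷-injectiveʳ)
open import Data.Vec.Relation.Binary.Pointwise.Inductive using (Pointwise; []; _∷_)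
open import Data.List using (List; []; _∷_; map; _++_; concatMap; allFin; length)
open import Data.List.Properties using (length-map; length-++; length-tabulate)
open import Data.List.Membership.Propositional using (_∈_; find; lose)
open import Data.List.Membership.Propositional.Properties
  using (∈-map⁺; ∈-map⁻; ∈-++⁺ˡ; ∈-++⁺ʳ; ∈-concatMap⁺; ∈-concatMap⁻; ∈-allFin)
open import Data.List.Relation.Unary.Any using (here)
open import Data.List.Relation.Unary.All as All using (All; []; _∷_)
import Data.List.Relation.Unary.All.Properties as Allₚ
open import Data.List.Relation.Unary.AllPairs using ([]; _∷_)
open import Data.List.Relation.Unary.Unique.Propositional using (Unique)
import Data.List.Relation.Unary.Unique.Propositional.Properties as Unique
open import Data.Product using (∃-syntax; _×_; _,_)
open import Data.Unit using (⊤; tt)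
open import Data.Empty using (⊥-elim)
open import Relation.Nullary using (¬_; yes; no)
open import Relation.Binary.PropositionalEquality
open import Function.Bundles using (_⇔_; mk⇔)
open import Function.Construct.Composition using (_⇔-∘_)

open ≡-Reasoning

-- A cut tree is 2-alternating exactly when no vertex has a child of its own colour: the
-- principal cuts of a box are its root cut together with the principal cuts of its two halves
-- in the same direction. Such trees are fixed by structTree, so the structures to count are the
-- binary trees with n vertices whose root takes any of d colours and whose other vertices take
-- any colour but their parent's, which gives d (d-1)^(n-1) times the number C_n of binary
-- trees. The enumeration generalises to forests in which every root must avoid a prescribed
-- colour; forests of k trees with n vertices in all are counted by the ballot numbers
-- forestCount n k, and their closed form in factorials gives forestCount n 1 = C_n.

-- The first tree of the forest is a leaf, or a vertex whose two subtrees join the other trees.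
forestCount : ℕ → ℕ → ℕ
forestCount zero    k       = 1
forestCount (suc n) zero    = 0
forestCount (suc n) (suc k) = forestCount (suc n) k + forestCount n (suc (suc k))

private
  closedForm-suc-zero : ∀ n a f x y → a * (f * x) ≡ 2 * y →
    a * (suc n * f * x) ≡ 1 * (suc (suc (n + n)) * y)
  closedForm-suc-zero n a f x y ih = begin
    a * (suc n * f * x)         ≡⟨ pull n a f x ⟩
    suc n * (a * (f * x))       ≡⟨ cong (suc n *_) ih ⟩
    suc n * (2 * y)             ≡⟨ push n y ⟩
    1 * (suc (suc (n + n)) * y) ∎
    where
    pull : ∀ n a f x → a * (suc n * f * x) ≡ suc n * (a * (f * x))
    pull = solve-∀
    push : ∀ n y → suc n * (2 * y) ≡ 1 * (suc (suc (n + n)) * y)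
    push = solve-∀

  closedForm-suc-suc : ∀ n k a b f x y →
    a * (suc n * f * x) ≡ suc k * y →
    b * (f * (suc (k + suc (suc n)) * x)) ≡ suc (suc (suc k)) * y →
    (a + b) * (suc n * f * (suc (k + suc (suc n)) * x)) ≡ suc (suc k) * (suc (k + suc n + suc n) * y)
  closedForm-suc-suc n k a b f x y ih₁ ih₂ = begin
    (a + b) * (suc n * f * (suc (k + suc (suc n)) * x))
      ≡⟨ expand n k a b f x ⟩
    suc (k + suc (suc n)) * (a * (suc n * f * x)) + suc n * (b * (f * (suc (k + suc (suc n)) * x)))
      ≡⟨ cong₂ (λ u v → suc (k + suc (suc n)) * u + suc n * v) ih₁ ih₂ ⟩
    suc (k + suc (suc n)) * (suc k * y) + suc n * (suc (suc (suc k)) * y)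
      ≡⟨ collect n k y ⟩
    suc (suc k) * (suc (k + suc n + suc n) * y) ∎
    where
    expand : ∀ n k a b f x → (a + b) * (suc n * f * (suc (k + suc (suc n)) * x)) ≡
      suc (k + suc (suc n)) * (a * (suc n * f * x)) + suc n * (b * (f * (suc (k + suc (suc n)) * x)))
    expand = solve-∀
    collect : ∀ n k y → suc (k + suc (suc n)) * (suc k * y) + suc n * (suc (suc (suc k)) * y) ≡
      suc (suc k) * (suc (k + suc n + suc n) * y)
    collect = solve-∀

-- Division-free form of forestCount n (k + 1) = (k + 1) (2n + k)! / (n! (n + k + 1)!); writing
-- the indices as k + … makes most of them agree definitionally along the induction.
forestCount-closedForm : ∀ n k →
  forestCount n (suc k) * (n ! * (k + suc n) !) ≡ suc k * (k + n + n) !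
forestCount-closedForm zero k = begin
  1 * (1 * (k + 1) !)    ≡⟨ *-identityˡ _ ⟩
  1 * (k + 1) !          ≡⟨ *-identityˡ _ ⟩
  (k + 1) !              ≡⟨ cong _! (+-comm k 1) ⟩
  suc k * k !            ≡⟨ cong (λ i → suc k * i !) (+-identityʳ k) ⟨
  suc k * (k + 0) !      ≡⟨ cong (λ i → suc k * i !) (+-identityʳ (k + 0)) ⟨
  suc k * (k + 0 + 0) !  ∎
forestCount-closedForm (suc n) zero = begin
  forestCount n 2 * (suc n ! * (suc (suc n)) !)
    ≡⟨ closedForm-suc-zero n (forestCount n 2) (n !) (suc (suc n) !) (suc (n + n) !)
         (forestCount-closedForm n 1) ⟩
  1 * (suc (suc (n + n)) * suc (n + n) !)
    ≡⟨ cong (λ i → 1 * suc i !) (+-suc n n) ⟨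
  1 * (suc n + suc n) !  ∎
forestCount-closedForm (suc n) (suc k) =
  closedForm-suc-suc n k (forestCount (suc n) (suc k)) (forestCount n (3 + k)) (n !)
    ((k + suc (suc n)) !) ((k + suc n + suc n) !) (forestCount-closedForm (suc n) k) ih₂
  where
  ih₂ : forestCount n (3 + k) * (n ! * (suc (k + suc (suc n))) !) ≡ (3 + k) * (k + suc n + suc n) !
  ih₂ = begin
    forestCount n (3 + k) * (n ! * (suc (k + suc (suc n))) !)
      ≡⟨ cong (λ i → forestCount n (3 + k) * (n ! * suc i !)) (+-suc k (suc n)) ⟩
    forestCount n (3 + k) * (n ! * (2 + k + suc n) !)
      ≡⟨ forestCount-closedForm n (2 + k) ⟩
    (3 + k) * (2 + k + n + n) !
      ≡⟨ cong (λ i → (3 + k) * i !) (shift n k) ⟩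
    (3 + k) * (k + suc n + suc n) ! ∎
    where
    shift : ∀ n k → 2 + k + n + n ≡ k + suc n + suc n
    shift = solve-∀

catalan≡forestCount : ∀ n → catalan n ≡ forestCount n 1
catalan≡forestCount n = begin
  ((2 * n) C n) / suc n             ≡⟨ /-congˡ central ⟩
  forestCount n 1 * suc n / suc n   ≡⟨ m*n/n≡m (forestCount n 1) (suc n) ⟩
  forestCount n 1                   ∎
  where
  central : (2 * n) C n ≡ forestCount n 1 * suc n
  central = begin
    (2 * n) C n
      ≡⟨ nCk≡n!/k![n-k]! (m≤m+n n (n + 0)) ⟩
    (2 * n) ! / (n ! * (2 * n ∸ n) !)
      ≡⟨ /-congʳ (cong (λ i → n ! * i !) 2n∸n≡n) ⟩
    (2 * n) ! / (n ! * n !)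
      ≡⟨ /-congˡ factorials ⟩
    forestCount n 1 * suc n * (n ! * n !) / (n ! * n !)
      ≡⟨ m*n/n≡m (forestCount n 1 * suc n) (n ! * n !) ⟩
    forestCount n 1 * suc n ∎
    where
    instance
      n!*n!≢0 : NonZero (n ! * n !)
      n!*n!≢0 = n !* n !≢0
      n!*[2n∸n]!≢0 : NonZero (n ! * (2 * n ∸ n) !)
      n!*[2n∸n]!≢0 = n !* (2 * n ∸ n) !≢0
    2n∸n≡n : 2 * n ∸ n ≡ n
    2n∸n≡n = trans (m+n∸m≡n n (n + 0)) (+-identityʳ n)
    regroup : ∀ a n f → a * (f * (suc n * f)) ≡ a * suc n * (f * f)
    regroup = solve-∀
    factorials : (2 * n) ! ≡ forestCount n 1 * suc n * (n ! * n !)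
    factorials = begin
      (n + (n + 0)) !                        ≡⟨ cong (λ i → (n + i) !) (+-identityʳ n) ⟩
      (n + n) !                              ≡⟨ *-identityˡ _ ⟨
      1 * (n + n) !                          ≡⟨ forestCount-closedForm n 0 ⟨
      forestCount n 1 * (n ! * suc n !)      ≡⟨ regroup (forestCount n 1) n (n !) ⟩
      forestCount n 1 * suc n * (n ! * n !)  ∎

length-concatMap-const : ∀ {a b} {A : Set a} {B : Set b} (f : A → List B) {c} xs →
  (∀ x → length (f x) ≡ c) → length (concatMap f xs) ≡ length xs * c
length-concatMap-const f []       _ = refl
length-concatMap-const f (x ∷ xs) h =
  trans (length-++ (f x)) (cong₂ _+_ (h x) (length-concatMap-const f xs h))

Unique-concatMap⁺ : ∀ {a b} {A : Set a} {B : Set b} (f : A → List B) {xs} →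
  Unique xs → (∀ x → Unique (f x)) →
  (∀ {x y v} → v ∈ f x → v ∈ f y → x ≡ y) → Unique (concatMap f xs)
Unique-concatMap⁺ f {[]}     []         _     _        = []
Unique-concatMap⁺ f {x ∷ xs} (x∉ ∷ xs!) f-uniq f-disjoint =
  Unique.++⁺ (f-uniq x) (Unique-concatMap⁺ f xs! f-uniq f-disjoint) disjoint
  where
  disjoint : ∀ {v} → ¬ (v ∈ f x × v ∈ concatMap f xs)
  disjoint (v∈fx , v∈rest) with y , y∈xs , v∈fy ← find (∈-concatMap⁻ f v∈rest) =
    All.lookup x∉ y∈xs (f-disjoint v∈fx v∈fy)

module _ {d : ℕ} where

  RootAvoids : Fin d → Tree d → Set
  RootAvoids c leaf         = ⊤
  RootAvoids c (node j _ _) = c ≢ j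

  data Alternating : Tree d → Set where
    leaf : Alternating leaf
    node : ∀ {j l r} → RootAvoids j l → RootAvoids j r →
           Alternating l → Alternating r → Alternating (node j l r)

  principal-node : ∀ (j : Fin d) l r → principal (node j l r) ≡ suc (principalIn j l + principalIn j r)
  principal-node j l r with j ≟ j
  ... | yes _  = +-suc (principalIn j l) (principalIn j r)
  ... | no j≢j = ⊥-elim (j≢j refl)

  RootAvoids⇒principalIn≡0 : ∀ j t → RootAvoids j t → principalIn j t ≡ 0
  RootAvoids⇒principalIn≡0 j leaf           _   = refl
  RootAvoids⇒principalIn≡0 j (node j′ _ _) j≢j′ with j ≟ j′
  ... | yes j≡j′ = ⊥-elim (j≢j′ j≡j′)
  ... | no  _    = refl

  principalIn≡0⇒RootAvoids : ∀ j t → principalIn j t ≡ 0 → RootAvoids j t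
  principalIn≡0⇒RootAvoids j leaf          _ = tt
  principalIn≡0⇒RootAvoids j (node j′ l _) p≡0 with j ≟ j′
  ... | yes _    = ⊥-elim (m+1+n≢0 (principalIn j l) p≡0)
  ... | no j≢j′  = j≢j′

  Alternating⇒TwoAlternating : ∀ {t} → Alternating t → TwoAlternating t
  Alternating⇒TwoAlternating leaf = leaf
  Alternating⇒TwoAlternating {node j l r} (node j∉l j∉r alt-l alt-r) =
    node (≤-reflexive (begin
            principal (node j l r)                   ≡⟨ principal-node j l r ⟩
            suc (principalIn j l + principalIn j r)  ≡⟨ cong₂ (λ x y → suc (x + y))
                                                          (RootAvoids⇒principalIn≡0 j l j∉l)
                                                          (RootAvoids⇒principalIn≡0 j r j∉r) ⟩
            1                                        ∎))
         (Alternating⇒TwoAlternating alt-l) (Alternating⇒TwoAlternating alt-r)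

  TwoAlternating⇒Alternating : ∀ {t} → TwoAlternating t → Alternating t
  TwoAlternating⇒Alternating leaf = leaf
  TwoAlternating⇒Alternating {node j l r} (node principal≤1 two-l two-r) =
    node (principalIn≡0⇒RootAvoids j l (m+n≡0⇒m≡0 (principalIn j l) no-other-principal-cuts))
         (principalIn≡0⇒RootAvoids j r (m+n≡0⇒n≡0 (principalIn j l) no-other-principal-cuts))
         (TwoAlternating⇒Alternating two-l) (TwoAlternating⇒Alternating two-r)
    where
    no-other-principal-cuts : principalIn j l + principalIn j r ≡ 0
    no-other-principal-cuts = n≤0⇒n≡0 (s≤s⁻¹ (subst (_≤ 1) (principal-node j l r) principal≤1))

  attach-RootAvoids : ∀ j l r → RootAvoids j r → attach j l r ≡ node j l r
  attach-RootAvoids j l leaf           _    = refl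
  attach-RootAvoids j l (node j′ _ _) j≢j′ with j ≟ j′
  ... | yes j≡j′ = ⊥-elim (j≢j′ j≡j′)
  ... | no  _    = refl

  structTree-Alternating : ∀ {t} → Alternating t → structTree t ≡ t
  structTree-Alternating leaf = refl
  structTree-Alternating {node j l r} (node _ j∉r alt-l alt-r) =
    trans (cong₂ (attach j) (structTree-Alternating alt-l) (structTree-Alternating alt-r))
          (attach-RootAvoids j l r j∉r)

  alternating⇔IsTwoAltStructure : ∀ n t → (Alternating t × size t ≡ n) ⇔ IsTwoAltStructure d n t
  alternating⇔IsTwoAltStructure n t = mk⇔ to from
    where
    to : Alternating t × size t ≡ n → IsTwoAltStructure d n t
    to (alt-t , size-t) = t , Alternating⇒TwoAlternating alt-t , size-t , structTree-Alternating alt-t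
    from : IsTwoAltStructure d n t → Alternating t × size t ≡ n
    from (p , two-p , size-p , refl) =
      let alt-p = TwoAlternating⇒Alternating two-p
          p≡t   = structTree-Alternating alt-p
      in subst Alternating (sym p≡t) alt-p , trans (cong size p≡t) size-p

module Enumeration (m : ℕ) where

  private
    Colour : Set
    Colour = Fin (suc m)

    Forest : ℕ → Set
    Forest = Vec (Tree (suc m))

  otherColours : Colour → List Colour
  otherColours c = map (punchIn c) (allFin m)

  length-otherColours : ∀ c → length (otherColours c) ≡ m
  length-otherColours c = trans (length-map (punchIn c) (allFin m)) (length-tabulate (λ i → i))

  otherColours-unique : ∀ c → Unique (otherColours c)
  otherColours-unique c = Unique.map⁺ (punchIn-injective c _ _) (Unique.allFin⁺ m)

  ∈-otherColours⁻ : ∀ {c c′} → c′ ∈ otherColours c → c ≢ c′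
  ∈-otherColours⁻ {c} c′∈ c≡c′ with i , _ , refl ← ∈-map⁻ (punchIn c) c′∈ =
    punchInᵢ≢i c i (sym c≡c′)

  ∈-otherColours⁺ : ∀ {c c′} → c ≢ c′ → c′ ∈ otherColours c
  ∈-otherColours⁺ {c} c≢c′ =
    subst (_∈ otherColours c) (punchIn-punchOut c≢c′) (∈-map⁺ (punchIn c) (∈-allFin _))

  Admissible : Colour → Tree (suc m) → Set
  Admissible c t = RootAvoids c t × Alternating t

  forestSize : ∀ {k} → Forest k → ℕ
  forestSize ts = Vec.sum (Vec.map size ts)

  forestSize-pair : ∀ l r → forestSize (l ∷ r ∷ []) ≡ size l + size r
  forestSize-pair l r = cong (size l +_) (+-identityʳ (size r))

  IsForest : ∀ {k} → ℕ → Vec Colour k → Forest k → Set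
  IsForest n cs ts = Pointwise Admissible cs ts × forestSize ts ≡ n

  IsForest-leaf⁺ : ∀ {k n c} {cs : Vec Colour k} {ts} →
    IsForest n cs ts → IsForest n (c ∷ cs) (leaf ∷ ts)
  IsForest-leaf⁺ (ps , size-ts) = (tt , leaf) ∷ ps , size-ts

  IsForest-leaf⁻ : ∀ {k n c} {cs : Vec Colour k} {ts} →
    IsForest n (c ∷ cs) (leaf ∷ ts) → IsForest n cs ts
  IsForest-leaf⁻ (_ ∷ ps , size-ts) = ps , size-ts


  graft : ∀ {k} → Colour → Forest (2 + k) → Forest (1 + k)
  graft c (l ∷ r ∷ ts) = node c l r ∷ ts

  graft-injective : ∀ {k} c {x y : Forest (2 + k)} → graft c x ≡ graft c y → x ≡ y
  graft-injective c {_ ∷ _ ∷ _} {_ ∷ _ ∷ _} refl = refl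

  graft-colour : ∀ {k c c′} {x y : Forest (2 + k)} → graft c x ≡ graft c′ y → c ≡ c′
  graft-colour {x = _ ∷ _ ∷ _} {_ ∷ _ ∷ _} refl = refl

  graft≢leaf∷ : ∀ {k c} (x : Forest (2 + k)) {ts} → graft c x ≢ leaf ∷ ts
  graft≢leaf∷ (_ ∷ _ ∷ _) ()

  IsForest-graft⁺ : ∀ {k n c c′} {cs : Vec Colour k} {w} → c ≢ c′ →
    IsForest n (c′ ∷ c′ ∷ cs) w → IsForest (suc n) (c ∷ cs) (graft c′ w)
  IsForest-graft⁺ {w = l ∷ r ∷ _} c≢c′ ((c′∉l , alt-l) ∷ (c′∉r , alt-r) ∷ ps , refl) =
    (c≢c′ , node c′∉l c′∉r alt-l alt-r) ∷ ps , cong suc (+-assoc (size l) (size r) _)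

  IsForest-graft⁻ : ∀ {k n c c′} {cs : Vec Colour k} w →
    IsForest (suc n) (c ∷ cs) (graft c′ w) → c ≢ c′ × IsForest n (c′ ∷ c′ ∷ cs) w
  IsForest-graft⁻ (l ∷ r ∷ _) ((c≢c′ , node c′∉l c′∉r alt-l alt-r) ∷ ps , size-w) =
    c≢c′ , ((c′∉l , alt-l) ∷ (c′∉r , alt-r) ∷ ps ,
            trans (sym (+-assoc (size l) (size r) _)) (suc-injective size-w))

  mutual
    forests : ∀ {k} → ℕ → Vec Colour k → List (Forest k)
    forests zero    []       = [] ∷ []
    forests (suc n) []       = []
    forests zero    (c ∷ cs) = map (leaf ∷_) (forests zero cs)
    forests (suc n) (c ∷ cs) = map (leaf ∷_) (forests (suc n) cs) ++ grafts n cs (otherColours c)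

    grafts : ∀ {k} → ℕ → Vec Colour k → List Colour → List (Forest (suc k))
    grafts n cs = concatMap (λ c → map (graft c) (forests n (c ∷ c ∷ cs)))

  ∈-grafts⁻ : ∀ {k} n (cs : Vec Colour k) cols {v} → v ∈ grafts n cs cols →
    ∃[ c ] ∃[ w ] (c ∈ cols × w ∈ forests n (c ∷ c ∷ cs) × v ≡ graft c w)
  ∈-grafts⁻ n cs cols v∈
    with c , c∈ , v∈′ ← find (∈-concatMap⁻ (λ c → map (graft c) (forests n (c ∷ c ∷ cs))) v∈)
    with w , w∈ , refl ← ∈-map⁻ (graft c) v∈′
    = c , w , c∈ , w∈ , refl

  ∈-grafts⁺ : ∀ {k} n (cs : Vec Colour k) cols {c w} →
    c ∈ cols → w ∈ forests n (c ∷ c ∷ cs) → graft c w ∈ grafts n cs cols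
  ∈-grafts⁺ n cs cols c∈ w∈ = ∈-concatMap⁺ _ (lose c∈ (∈-map⁺ _ w∈))

  mutual
    length-forests : ∀ {k} n (cs : Vec Colour k) → length (forests n cs) ≡ m ^ n * forestCount n k
    length-forests zero    []       = refl
    length-forests (suc n) []       = sym (*-zeroʳ (m ^ suc n))
    length-forests zero    (c ∷ cs) = trans (length-map _ (forests zero cs)) (length-forests zero cs)
    length-forests {suc k} (suc n) (c ∷ cs) = begin
      length (map (leaf ∷_) (forests (suc n) cs) ++ grafts n cs (otherColours c))
        ≡⟨ length-++ (map (leaf ∷_) (forests (suc n) cs)) ⟩
      length (map (leaf ∷_) (forests (suc n) cs)) + length (grafts n cs (otherColours c))
        ≡⟨ cong₂ _+_ (trans (length-map _ (forests (suc n) cs)) (length-forests (suc n) cs))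
                     (length-grafts n cs (otherColours c)) ⟩
      m ^ suc n * forestCount (suc n) k + length (otherColours c) * (m ^ n * forestCount n (2 + k))
        ≡⟨ cong (λ x → m ^ suc n * forestCount (suc n) k + x * (m ^ n * forestCount n (2 + k)))
                (length-otherColours c) ⟩
      m ^ suc n * forestCount (suc n) k + m * (m ^ n * forestCount n (2 + k))
        ≡⟨ factor m (m ^ n) (forestCount (suc n) k) (forestCount n (2 + k)) ⟩
      m ^ suc n * forestCount (suc n) (suc k) ∎
      where
      factor : ∀ m p a b → m * p * a + m * (p * b) ≡ m * p * (a + b)
      factor = solve-∀

    length-grafts : ∀ {k} n (cs : Vec Colour k) cols →
      length (grafts n cs cols) ≡ length cols * (m ^ n * forestCount n (2 + k))
    length-grafts n cs cols = length-concatMap-const _ cols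
      (λ c → trans (length-map (graft c) (forests n (c ∷ c ∷ cs))) (length-forests n (c ∷ c ∷ cs)))

  mutual
    forests-unique : ∀ {k} n (cs : Vec Colour k) → Unique (forests n cs)
    forests-unique zero    []       = [] ∷ []
    forests-unique (suc n) []       = []
    forests-unique zero    (c ∷ cs) = Unique.map⁺ ∷-injectiveʳ (forests-unique zero cs)
    forests-unique (suc n) (c ∷ cs) =
      Unique.++⁺ (Unique.map⁺ ∷-injectiveʳ (forests-unique (suc n) cs))
                 (grafts-unique n cs (otherColours-unique c))
                 leaf-first≢graft
      where
      leaf-first≢graft : ∀ {v} →
        ¬ (v ∈ map (leaf ∷_) (forests (suc n) cs) × v ∈ grafts n cs (otherColours c))
      leaf-first≢graft (v∈₁ , v∈₂)
        with _ , _ , refl ← ∈-map⁻ _ v∈₁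
        with _ , w , _ , _ , v≡ ← ∈-grafts⁻ n cs (otherColours c) v∈₂
        = graft≢leaf∷ w (sym v≡)

    grafts-unique : ∀ {k} n (cs : Vec Colour k) {cols} → Unique cols → Unique (grafts n cs cols)
    grafts-unique n cs cols! = Unique-concatMap⁺ _ cols!
      (λ c → Unique.map⁺ (graft-injective c) (forests-unique n (c ∷ c ∷ cs)))
      same-colour
      where
      same-colour : ∀ {c c′ v} → v ∈ map (graft c) (forests n (c ∷ c ∷ cs)) →
                    v ∈ map (graft c′) (forests n (c′ ∷ c′ ∷ cs)) → c ≡ c′
      same-colour {c} {c′} v∈₁ v∈₂
        with _ , _ , v≡₁ ← ∈-map⁻ (graft c) v∈₁
        with _ , _ , v≡₂ ← ∈-map⁻ (graft c′) v∈₂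
        = graft-colour (trans (sym v≡₁) v≡₂)

  mutual
    forests-sound : ∀ {k} n (cs : Vec Colour k) → All (IsForest n cs) (forests n cs)
    forests-sound zero    []       = ([] , refl) ∷ []
    forests-sound (suc n) []       = []
    forests-sound zero    (c ∷ cs) = Allₚ.map⁺ (All.map IsForest-leaf⁺ (forests-sound zero cs))
    forests-sound (suc n) (c ∷ cs) =
      Allₚ.++⁺ (Allₚ.map⁺ (All.map IsForest-leaf⁺ (forests-sound (suc n) cs))) (grafts-sound n cs c)

    grafts-sound : ∀ {k} n (cs : Vec Colour k) c →
      All (IsForest (suc n) (c ∷ cs)) (grafts n cs (otherColours c))
    grafts-sound n cs c = Allₚ.concat⁺ (Allₚ.map⁺ (All.tabulate λ {c′} c′∈ →
      Allₚ.map⁺ (All.map (IsForest-graft⁺ (∈-otherColours⁻ c′∈))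
                         (forests-sound n (c′ ∷ c′ ∷ cs)))))

  forests-complete : ∀ {k} n (cs : Vec Colour k) {ts} → IsForest n cs ts → ts ∈ forests n cs
  forests-complete zero    []       {[]} _ = here refl
  forests-complete zero    (c ∷ cs) {leaf ∷ _} F =
    ∈-map⁺ _ (forests-complete zero cs (IsForest-leaf⁻ F))
  forests-complete (suc n) (c ∷ cs) {leaf ∷ _} F =
    ∈-++⁺ˡ (∈-map⁺ _ (forests-complete (suc n) cs (IsForest-leaf⁻ F)))
  forests-complete (suc n) (c ∷ cs) {node c′ l r ∷ ts} F =
    let c≢c′ , F′ = IsForest-graft⁻ (l ∷ r ∷ ts) F
    in ∈-++⁺ʳ (map (leaf ∷_) (forests (suc n) cs))
              (∈-grafts⁺ n cs (otherColours c) (∈-otherColours⁺ c≢c′)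
                         (forests-complete n (c′ ∷ c′ ∷ cs) F′))

  alternatingTrees : ℕ → List (Tree (suc m))
  alternatingTrees n = map head (grafts n [] (allFin (suc m)))

  length-alternatingTrees : ∀ n → length (alternatingTrees n) ≡ suc m * (m ^ n * forestCount n 2)
  length-alternatingTrees n = begin
    length (map head (grafts n [] (allFin (suc m))))
      ≡⟨ length-map head (grafts n [] (allFin (suc m))) ⟩
    length (grafts n [] (allFin (suc m)))
      ≡⟨ length-grafts n [] (allFin (suc m)) ⟩
    length (allFin (suc m)) * (m ^ n * forestCount n 2)
      ≡⟨ cong (_* (m ^ n * forestCount n 2)) (length-tabulate {n = suc m} (λ i → i)) ⟩
    suc m * (m ^ n * forestCount n 2)                 ∎

  alternatingTrees-unique : ∀ n → Unique (alternatingTrees n)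
  alternatingTrees-unique n = Unique.map⁺ head-injective (grafts-unique n [] (Unique.allFin⁺ (suc m)))
    where
    head-injective : ∀ {x y : Forest 1} → head x ≡ head y → x ≡ y
    head-injective {_ ∷ []} {_ ∷ []} refl = refl

  ∈-alternatingTrees : ∀ n t → t ∈ alternatingTrees n ⇔ (Alternating t × size t ≡ suc n)
  ∈-alternatingTrees n t = mk⇔ to from
    where
    to : t ∈ alternatingTrees n → Alternating t × size t ≡ suc n
    to t∈ with v , v∈ , refl ← ∈-map⁻ head t∈
          with c , l ∷ r ∷ [] , _ , w∈ , refl ← ∈-grafts⁻ n [] (allFin (suc m)) v∈
          with (c∉l , alt-l) ∷ (c∉r , alt-r) ∷ [] , size-w ← All.lookup (forests-sound n (c ∷ c ∷ [])) w∈
      = node c∉l c∉r alt-l alt-r , cong suc (trans (sym (forestSize-pair l r)) size-w)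
    from : Alternating t × size t ≡ suc n → t ∈ alternatingTrees n
    from (node {c} {l} {r} c∉l c∉r alt-l alt-r , size-t) =
      ∈-map⁺ head (∈-grafts⁺ n [] (allFin (suc m)) (∈-allFin c)
        (forests-complete n (c ∷ c ∷ [])
          ((c∉l , alt-l) ∷ (c∉r , alt-r) ∷ [] ,
           trans (forestSize-pair l r) (suc-injective size-t))))

mainTheorem12 : (d n : ℕ) → d ≥ 1 → n ≥ 1 →
    NumTwoAlt d n (d * (d ∸ 1) ^ (n ∸ 1) * catalan n)
mainTheorem12 (suc m) (suc n) (s≤s z≤n) (s≤s z≤n) =
  alternatingTrees n , alternatingTrees-unique n , count ,
  λ t → alternating⇔IsTwoAltStructure (suc n) t ⇔-∘ ∈-alternatingTrees n t
  where
  open Enumeration m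
  count : length (alternatingTrees n) ≡ suc m * m ^ n * catalan (suc n)
  count = begin
    length (alternatingTrees n)          ≡⟨ length-alternatingTrees n ⟩
    suc m * (m ^ n * forestCount n 2)    ≡⟨ *-assoc (suc m) (m ^ n) (forestCount n 2) ⟨
    suc m * m ^ n * forestCount n 2      ≡⟨ cong (suc m * m ^ n *_) (catalan≡forestCount (suc n)) ⟨
    suc m * m ^ n * catalan (suc n)      ∎
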